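{- Let $r\ge1$, $\delta\ge1$ and $0\le m\le r$ be integers, and let $H$ be an $r$-uniform hypergraph with $\delta_m(H)=\delta$. Then for all $n\ge|V(H)|$, \[\mathrm{wsat}(n,H)\ge\frac{\delta-1}{\binom{r}{m}}\binom{n}{m}.\]
   Context: An $r$-uniform hypergraph $H$ has a finite vertex set $V(H)$ and edge set $E(H)\subseteq\binom{V(H)}{r}$; it is non-empty if $|E(H)|\ge1$. $K_n^r$ is the complete $r$-uniform hypergraph on $n$ vertices. For non-empty $H$, $F$ on $n$ vertices is weakly $H$-saturated if the edges of $E(K_n^r)\setminus E(F)$ can be ordered $e_1,\dots,e_k$ so that each $F\cup\{e_1,\dots,e_i\}$ contains a copy of $H$ containing $e_i$; $\mathrm{wsat}(n,H)$ is the minimum number of edges of such $F$. For $U\subseteq V(H)$, $L_H(U)=\{e\setminus U: e\in E(H),\ U\subseteq e\}$. For non-empty $H$, $\delta_m(H)=\min\{|L_H(U)|: U\in\binom{V(H)}{m},\ |L_H(U)|\neq0\}$; for empty $H$, $\delta_m(H)=-1$. -}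

module Defs where

open import Data.Nat using (ℕ; zero; suc; _≤_)
open import Data.Empty using (⊥)
open import Data.Bool using (Bool; true; false; _∧_; _∨_; not; if_then_else_)
open import Data.Fin using (Fin)
open import Data.Fin.Subset using (Subset; _∈_; ∣_∣; _─_)
open import Data.Vec using (Vec; []; _∷_)
open import Data.List using (List; []; _∷_; _++_; map; length; filterᵇ)
open import Data.Bool.ListAction using (any)
import Data.List.Membership.Propositional as LM
open import Data.List.Relation.Unary.Unique.Propositional using (Unique)
open import Data.Product using (Σ; ∃; _×_; _,_)
open import Data.Unit using (⊤)
open import Function using (_⇔_)
open import Function.Definitions using (Injective)
open import Relation.Binary.PropositionalEquality using (_≡_)

allSubsets : (n : ℕ) → List (Subset n)
allSubsets zero = [] ∷ []
allSubsets (suc n) = map (false ∷_) (allSubsets n) ++ map (true ∷_) (allSubsets n)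

_⊆ᵇ_ : ∀ {n} → Subset n → Subset n → Bool
[] ⊆ᵇ [] = true
(x ∷ xs) ⊆ᵇ (y ∷ ys) = (not x ∨ y) ∧ (xs ⊆ᵇ ys)

_==ᵇ_ : ∀ {n} → Subset n → Subset n → Bool
[] ==ᵇ [] = true
(x ∷ xs) ==ᵇ (y ∷ ys) = (if x then y else not y) ∧ (xs ==ᵇ ys)

Hypergraph : ℕ → Set
Hypergraph n = Subset n → Bool

IsEdge : ∀ {n} → Hypergraph n → Subset n → Set
IsEdge G e = G e ≡ true

Uniform : ∀ {n} → ℕ → Hypergraph n → Set
Uniform r G = ∀ e → IsEdge G e → ∣ e ∣ ≡ r

NonEmpty : ∀ {n} → Hypergraph n → Set
NonEmpty G = ∃ λ e → IsEdge G e

numEdges : ∀ {n} → Hypergraph n → ℕ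
numEdges {n} G = length (filterᵇ G (allSubsets n))

link : ∀ {n} → Hypergraph n → Subset n → Subset n → Bool
link {n} H U t = any (λ e → H e ∧ (U ⊆ᵇ e) ∧ ((e ─ U) ==ᵇ t)) (allSubsets n)

linkSize : ∀ {n} → Hypergraph n → Subset n → ℕ
linkSize {n} H U = length (filterᵇ (link H U) (allSubsets n))

-- δ_m(H) = δ for a non-empty H:  δ is the minimum of |L_H(U)| over
-- m-subsets U with |L_H(U)| ≠ 0.
MinCodegreeIs : ∀ {v} → Hypergraph v → ℕ → ℕ → Set
MinCodegreeIs H m δ =
  NonEmpty H ×
  (∃ λ U → ∣ U ∣ ≡ m × linkSize H U ≡ δ) ×
  (∀ U → ∣ U ∣ ≡ m → (linkSize H U ≡ 0 → ⊥) → δ ≤ linkSize H U)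

MapsOnto : ∀ {v n} → (Fin v → Fin n) → Subset v → Subset n → Set
MapsOnto φ h e = ∀ j → (j ∈ e ⇔ (∃ λ i → i ∈ h × φ i ≡ j))

ContainsCopyWith : ∀ {v n} → Hypergraph v → Hypergraph n → Subset n → Set
ContainsCopyWith H G e =
  ∃ λ (φ : Fin _ → Fin _) →
    Injective _≡_ _≡_ φ ×
    (∀ h → IsEdge H h → ∃ λ f → IsEdge G f × MapsOnto φ h f) ×
    (∃ λ h → IsEdge H h × MapsOnto φ h e)

addEdge : ∀ {n} → Hypergraph n → Subset n → Hypergraph n
addEdge G e f = G f ∨ (f ==ᵇ e)

SaturatingSeq : ∀ {v n} → Hypergraph v → Hypergraph n → List (Subset n) → Set
SaturatingSeq H G [] = ⊤
SaturatingSeq H G (e ∷ es) =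
  ContainsCopyWith H (addEdge G e) e × SaturatingSeq H (addEdge G e) es

WeaklySaturated : ∀ {v n} → ℕ → Hypergraph v → Hypergraph n → Set
WeaklySaturated {n = n} r H F =
  Uniform r F ×
  ∃ λ (es : List (Subset n)) →
    Unique es ×
    (∀ e → (e LM.∈ es ⇔ (∣ e ∣ ≡ r × F e ≡ false))) ×
    SaturatingSeq H F es

{-# OPTIONS --safe #-}

-- Every m-set W of vertices lies in at least δ − 1 edges of F.  Follow the
-- saturating sequence e₁, e₂, … .  If no eᵢ contains W, then every r-superset
-- of W is already an edge of F, and there are C(n − m, r − m) ≥ C(v − m, r − m)
-- of them, at least the size δ of the link of an extremal m-set of H.  Otherwise
-- the first eᵢ ⊇ W lies in a copy φ(H) inside F + e₁ + … + eᵢ; the preimage of W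
-- is an m-set of H inside an edge, so its link has at least δ elements, and these
-- give δ distinct edges of the copy through W, all in F except eᵢ itself.
-- Counting the pairs (W, f) with W ⊆ f ∈ F and ∣ W ∣ = m in both ways gives
-- (δ − 1) C(n, m) ≤ ∣ F ∣ C(r, m).

module Submission where

open import Defs
open import Data.Nat using (ℕ; _≤_; _*_; _∸_)
open import Data.Nat.Combinatorics using (_C_)

open import Data.Nat using (zero; suc; _+_; _≡ᵇ_; z≤n; s≤s)
open import Data.Nat.Properties
open import Algebra.Properties.CommutativeSemigroup +-commutativeSemigroup using (x∙yz≈y∙xz)
open import Data.Nat.Combinatorics using (nCk+nC[k+1]≡[n+1]C[k+1])
open import Data.Nat.ListAction using (sum)
open import Data.Bool using (Bool; true; false; T; _∧_; if_then_else_)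
open import Data.Bool.Properties using (T-≡; T-∧; T-∨; T?; ∧-identityʳ)
open import Data.Unit using (tt)
open import Data.Empty using (⊥-elim)
open import Data.Product using (∃; ∃-syntax; _×_; _,_; proj₂)
open import Data.Sum using (_⊎_; inj₁; inj₂)
open import Data.Fin as Fin using (Fin)
open import Data.Fin.Subset using (Subset; _∈_; _⊆_; ∣_∣; _─_; ⊤)
open import Data.Fin.Subset.Properties using (drop-∷-⊆; ∈⊤; ∣⊤∣≡n; ∣p∣≤n; p⊆q⇒∣p∣≤∣q∣; ⊆-antisym)
open import Data.Vec using ([]; _∷_; here; there)
import Data.Vec as Vec
open import Data.Vec.Properties using (∷-injectiveʳ; []=⇒lookup; lookup⇒[]=; lookup∘tabulate)
open import Data.List using (List; []; _∷_; _++_; map; length; filterᵇ; allFin; tabulate)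
open import Data.List.Properties using (length-map; length-++; map-cong; map-tabulate; filter-++; filter-none; filter-some)
open import Data.List.Membership.Propositional using (lose) renaming (_∈_ to _∈ₗ_)
open import Data.List.Membership.Propositional.Properties
  using (∈-filter⁺; ∈-filter⁻; ∈-map⁺; ∈-map⁻; ∈-++⁺ˡ; ∈-++⁺ʳ; ∈-++⁻; ∈-∃++; ∈-allFin)
open import Data.List.Relation.Unary.All as All using (All)
open import Data.List.Relation.Unary.Any using (Any; here; there; satisfied; any?)
open import Data.List.Relation.Unary.Any.Properties using (any⁺; any⁻)
open import Data.List.Relation.Unary.AllPairs using ([]; _∷_)
open import Data.List.Relation.Unary.Unique.Propositional using (Unique)
import Data.List.Relation.Unary.Unique.Propositional.Properties as Unique
open import Function using (id; _∘_; _⇔_; mk⇔; Equivalence)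
open import Function.Definitions using (Injective)
open import Relation.Binary.PropositionalEquality
open import Relation.Nullary using (¬_; yes; no; contradiction)

open Equivalence using (to; from)

private
  variable
    A B : Set

-- Counting in lists

count : (A → Bool) → List A → ℕ
count p xs = length (filterᵇ p xs)

unique-⊆⇒length≤ : {xs ys : List A} → Unique xs →
  (∀ {x} → x ∈ₗ xs → x ∈ₗ ys) → length xs ≤ length ys
unique-⊆⇒length≤ {xs = []} _ _ = z≤n
unique-⊆⇒length≤ {xs = x ∷ xs} (x∉xs ∷ xs!) xs⊆ys with ∈-∃++ (xs⊆ys (here refl))
... | as , bs , refl = begin
    suc (length xs)             ≤⟨ s≤s (unique-⊆⇒length≤ xs! xs⊆as++bs) ⟩
    suc (length (as ++ bs))     ≡⟨ cong suc (length-++ as) ⟩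
    suc (length as + length bs) ≡⟨ +-suc (length as) (length bs) ⟨
    length as + length (x ∷ bs) ≡⟨ length-++ as ⟨
    length (as ++ x ∷ bs)       ∎
  where
  open ≤-Reasoning
  xs⊆as++bs : ∀ {y} → y ∈ₗ xs → y ∈ₗ as ++ bs
  xs⊆as++bs y∈xs with ∈-++⁻ as (xs⊆ys (there y∈xs))
  ... | inj₁ y∈as         = ∈-++⁺ˡ y∈as
  ... | inj₂ (here refl)  = contradiction refl (All.lookup x∉xs y∈xs)
  ... | inj₂ (there y∈bs) = ∈-++⁺ʳ as y∈bs

count-≤-image : {p : A → Bool} {q : B → Bool} {xs : List A} {ys : List B} →
  (f : B → A) → Unique xs →
  (∀ {x} → x ∈ₗ xs → T (p x) → ∃[ y ] y ∈ₗ ys × T (q y) × f y ≡ x) →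
  count p xs ≤ count q ys
count-≤-image {p = p} {q} {xs} {ys} f xs! covered = begin
  count p xs                    ≤⟨ unique-⊆⇒length≤ (Unique.filter⁺ (T? ∘ p) xs!) ⊆image ⟩
  length (map f (filterᵇ q ys)) ≡⟨ length-map f (filterᵇ q ys) ⟩
  count q ys                    ∎
  where
  open ≤-Reasoning
  ⊆image : ∀ {x} → x ∈ₗ filterᵇ p xs → x ∈ₗ map f (filterᵇ q ys)
  ⊆image x∈ with ∈-filter⁻ (T? ∘ p) {xs = xs} x∈
  ... | x∈xs , px with covered x∈xs px
  ... | y , y∈ys , qy , refl = ∈-map⁺ f (∈-filter⁺ (T? ∘ q) y∈ys qy)

count-≤-injective : {p : A → Bool} {q : B → Bool} {xs : List A} {ys : List B} →
  (f : A → B) → Injective _≡_ _≡_ f → Unique xs →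
  (∀ {x} → x ∈ₗ xs → T (p x) → f x ∈ₗ ys × T (q (f x))) →
  count p xs ≤ count q ys
count-≤-injective {p = p} {q} {xs} {ys} f f-inj xs! maps = begin
  count p xs                    ≡⟨ length-map f (filterᵇ p xs) ⟨
  length (map f (filterᵇ p xs)) ≤⟨ unique-⊆⇒length≤ (Unique.map⁺ f-inj (Unique.filter⁺ (T? ∘ p) xs!)) ⊆filter ⟩
  count q ys                    ∎
  where
  open ≤-Reasoning
  ⊆filter : ∀ {y} → y ∈ₗ map f (filterᵇ p xs) → y ∈ₗ filterᵇ q ys
  ⊆filter y∈ with ∈-map⁻ f y∈
  ... | x , x∈ , refl with ∈-filter⁻ (T? ∘ p) {xs = xs} x∈
  ... | x∈xs , px with maps x∈xs px
  ... | fx∈ys , qfx = ∈-filter⁺ (T? ∘ q) fx∈ys qfx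

count-≤-suc : {p q : A → Bool} {xs : List A} (y : A) → Unique xs →
  (∀ {x} → x ∈ₗ xs → T (p x) → x ≡ y ⊎ T (q x)) →
  count p xs ≤ suc (count q xs)
count-≤-suc {p = p} {q} {xs} y xs! p⇒y∨q =
  unique-⊆⇒length≤ (Unique.filter⁺ (T? ∘ p) xs!) ⊆y∷filter
  where
  ⊆y∷filter : ∀ {x} → x ∈ₗ filterᵇ p xs → x ∈ₗ y ∷ filterᵇ q xs
  ⊆y∷filter x∈ with ∈-filter⁻ (T? ∘ p) {xs = xs} x∈
  ... | x∈xs , px with p⇒y∨q x∈xs px
  ... | inj₁ refl = here refl
  ... | inj₂ qx   = there (∈-filter⁺ (T? ∘ q) x∈xs qx)

count-mono : {p q : A → Bool} → (∀ x → T (p x) → T (q x)) →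
  ∀ xs → count p xs ≤ count q xs
count-mono p⇒q [] = z≤n
count-mono {p = p} {q} p⇒q (x ∷ xs) with p x | q x | p⇒q x
... | true  | true  | _   = s≤s (count-mono p⇒q xs)
... | true  | false | px⇒qx = ⊥-elim (px⇒qx tt)
... | false | true  | _   = m≤n⇒m≤1+n (count-mono p⇒q xs)
... | false | false | _   = count-mono p⇒q xs

count-cong : {p q : A → Bool} → (∀ x → p x ≡ q x) → ∀ xs → count p xs ≡ count q xs
count-cong p≗q xs = ≤-antisym
  (count-mono (λ x → subst T (p≗q x)) xs)
  (count-mono (λ x → subst T (sym (p≗q x))) xs)

count-none : {p : A → Bool} → (∀ x → ¬ T (p x)) → ∀ xs → count p xs ≡ 0
count-none {p = p} ¬p xs = cong length (filter-none (T? ∘ p) (All.universal ¬p xs))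

count-≢0 : {p : A → Bool} {x : A} {xs : List A} → x ∈ₗ xs → T (p x) → count p xs ≢ 0
count-≢0 {p = p} x∈xs px = n>0⇒n≢0 (filter-some (T? ∘ p) (lose x∈xs px))

count-++ : (p : A → Bool) (xs ys : List A) → count p (xs ++ ys) ≡ count p xs + count p ys
count-++ p xs ys = trans (cong length (filter-++ (T? ∘ p) xs ys)) (length-++ (filterᵇ p xs))

count-∷ : (p : A → Bool) (x : A) (xs : List A) → count p (x ∷ xs) ≡ count p (x ∷ []) + count p xs
count-∷ p x xs with p x
... | true  = refl
... | false = refl

count-map : (p : B → Bool) (f : A → B) (xs : List A) → count p (map f xs) ≡ count (p ∘ f) xs
count-map p f [] = refl
count-map p f (x ∷ xs) with p (f x)
... | true  = cong suc (count-map p f xs)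
... | false = count-map p f xs

sum-mono : {f g : A → ℕ} → (∀ x → f x ≤ g x) → ∀ xs → sum (map f xs) ≤ sum (map g xs)
sum-mono f≤g []       = z≤n
sum-mono f≤g (x ∷ xs) = +-mono-≤ (f≤g x) (sum-mono f≤g xs)

sum-cong : {f g : A → ℕ} → (∀ x → f x ≡ g x) → ∀ xs → sum (map f xs) ≡ sum (map g xs)
sum-cong f≗g xs = cong sum (map-cong f≗g xs)

sum-map-if : (p : A → Bool) (a : ℕ) (xs : List A) →
  sum (map (λ x → if p x then a else 0) xs) ≡ a * count p xs
sum-map-if p a [] = sym (*-zeroʳ a)
sum-map-if p a (x ∷ xs) with p x
... | true  = trans (cong (a +_) (sum-map-if p a xs)) (sym (*-suc a _))
... | false = sum-map-if p a xs

double-counting : (R : A → B → Bool) (xs : List A) (ys : List B) →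
  sum (map (λ x → count (R x) ys) xs) ≡ sum (map (λ y → count (λ x → R x y) xs) ys)
double-counting R [] ys = sym (sum-zeros ys)
  where
  sum-zeros : ∀ ys → sum (map (λ (_ : B) → 0) ys) ≡ 0
  sum-zeros []       = refl
  sum-zeros (_ ∷ ys) = sum-zeros ys
double-counting R (x ∷ xs) ys = begin
  count (R x) ys + sum (map (λ x′ → count (R x′) ys) xs)
    ≡⟨ cong (count (R x) ys +_) (double-counting R xs ys) ⟩
  count (R x) ys + sum (map (λ y → count (λ x′ → R x′ y) xs) ys)
    ≡⟨ peel ys ⟨
  sum (map (λ y → count (λ x′ → R x′ y) (x ∷ xs)) ys)
    ∎
  where
  open ≡-Reasoning
  peel : ∀ ys → sum (map (λ y → count (λ x′ → R x′ y) (x ∷ xs)) ys)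
              ≡ count (R x) ys + sum (map (λ y → count (λ x′ → R x′ y) xs) ys)
  swap-first-two : ∀ ys c → c + sum (map (λ y → count (λ x′ → R x′ y) (x ∷ xs)) ys)
                          ≡ count (R x) ys + (c + sum (map (λ y → count (λ x′ → R x′ y) xs) ys))
  peel [] = refl
  peel (y ∷ ys) with R x y
  ... | true  = cong suc (swap-first-two ys (count (λ x′ → R x′ y) xs))
  ... | false = swap-first-two ys (count (λ x′ → R x′ y) xs)
  swap-first-two ys c = trans (cong (c +_) (peel ys)) (x∙yz≈y∙xz c (count (R x) ys) _)

-- Subsets of Fin n

allSubsets-complete : ∀ {n} (s : Subset n) → s ∈ₗ allSubsets n
allSubsets-complete []          = here refl
allSubsets-complete (false ∷ s) = ∈-++⁺ˡ (∈-map⁺ (false ∷_) (allSubsets-complete s))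
allSubsets-complete {suc n} (true ∷ s) =
  ∈-++⁺ʳ (map (false ∷_) (allSubsets n)) (∈-map⁺ (true ∷_) (allSubsets-complete s))

allSubsets-unique : ∀ n → Unique (allSubsets n)
allSubsets-unique zero    = All.[] ∷ []
allSubsets-unique (suc n) =
  Unique.++⁺ (Unique.map⁺ ∷-injectiveʳ (allSubsets-unique n))
             (Unique.map⁺ ∷-injectiveʳ (allSubsets-unique n))
             heads-differ
  where
  heads-differ : ∀ {s} → ¬ (s ∈ₗ map (false ∷_) (allSubsets n) × s ∈ₗ map (true ∷_) (allSubsets n))
  heads-differ (s∈₀ , s∈₁) with ∈-map⁻ (false ∷_) s∈₀ | ∈-map⁻ (true ∷_) s∈₁
  ... | _ , _ , refl | _ , _ , ()

count-allSubsets-suc : ∀ {n} (p : Subset (suc n) → Bool) →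
  count p (allSubsets (suc n)) ≡ count (p ∘ (false ∷_)) (allSubsets n) + count (p ∘ (true ∷_)) (allSubsets n)
count-allSubsets-suc {n} p = trans (count-++ p (map (false ∷_) (allSubsets n)) _)
  (cong₂ _+_ (count-map p (false ∷_) (allSubsets n)) (count-map p (true ∷_) (allSubsets n)))

⊆ᵇ⇒⊆ : ∀ {n} {p q : Subset n} → T (p ⊆ᵇ q) → p ⊆ q
⊆ᵇ⇒⊆ {p = true  ∷ _} {true  ∷ _} _    here       = here
⊆ᵇ⇒⊆ {p = true  ∷ _} {true  ∷ _} p⊆q (there i∈p) = there (⊆ᵇ⇒⊆ p⊆q i∈p)
⊆ᵇ⇒⊆ {p = false ∷ _} {_     ∷ _} p⊆q (there i∈p) = there (⊆ᵇ⇒⊆ p⊆q i∈p)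

⊆⇒⊆ᵇ : ∀ {n} {p q : Subset n} → p ⊆ q → T (p ⊆ᵇ q)
⊆⇒⊆ᵇ {p = []}        {[]}        _   = tt
⊆⇒⊆ᵇ {p = false ∷ _} {_     ∷ _} p⊆q = ⊆⇒⊆ᵇ (drop-∷-⊆ p⊆q)
⊆⇒⊆ᵇ {p = true  ∷ _} {true  ∷ _} p⊆q = ⊆⇒⊆ᵇ (drop-∷-⊆ p⊆q)
⊆⇒⊆ᵇ {p = true  ∷ _} {false ∷ _} p⊆q with p⊆q here
... | ()

==ᵇ⇒≡ : ∀ {n} {p q : Subset n} → T (p ==ᵇ q) → p ≡ q
==ᵇ⇒≡ {p = []}        {[]}        _   = refl
==ᵇ⇒≡ {p = true  ∷ _} {true  ∷ _} p=q = cong (true ∷_) (==ᵇ⇒≡ p=q)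
==ᵇ⇒≡ {p = false ∷ _} {false ∷ _} p=q = cong (false ∷_) (==ᵇ⇒≡ p=q)

==ᵇ-refl : ∀ {n} (p : Subset n) → T (p ==ᵇ p)
==ᵇ-refl []          = tt
==ᵇ-refl (true  ∷ p) = ==ᵇ-refl p
==ᵇ-refl (false ∷ p) = ==ᵇ-refl p

∈⇔T-lookup : ∀ {n} {i : Fin n} {S : Subset n} → i ∈ S ⇔ T (Vec.lookup S i)
∈⇔T-lookup {i = i} {S} = mk⇔ (from T-≡ ∘ []=⇒lookup) (lookup⇒[]= i S ∘ to T-≡)

count-allFin-suc : ∀ {n} (p : Fin (suc n) → Bool) →
  count p (allFin (suc n)) ≡ count p (Fin.zero ∷ []) + count (p ∘ Fin.suc) (allFin n)
count-allFin-suc {n} p = begin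
  count p (Fin.zero ∷ tabulate Fin.suc)                    ≡⟨ count-∷ p Fin.zero (tabulate Fin.suc) ⟩
  count p (Fin.zero ∷ []) + count p (tabulate Fin.suc)     ≡⟨ cong (λ xs → count p (Fin.zero ∷ []) + count p xs) (map-tabulate id Fin.suc) ⟨
  count p (Fin.zero ∷ []) + count p (map Fin.suc (allFin n)) ≡⟨ cong (count p (Fin.zero ∷ []) +_) (count-map p Fin.suc (allFin n)) ⟩
  count p (Fin.zero ∷ []) + count (p ∘ Fin.suc) (allFin n) ∎
  where open ≡-Reasoning

∣p∣≡count-lookup : ∀ {n} (p : Subset n) → ∣ p ∣ ≡ count (Vec.lookup p) (allFin n)
∣p∣≡count-lookup []          = refl
∣p∣≡count-lookup (true ∷ p)  = trans (cong suc (∣p∣≡count-lookup p)) (sym (count-allFin-suc (Vec.lookup (true ∷ p))))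
∣p∣≡count-lookup (false ∷ p) = trans (∣p∣≡count-lookup p) (sym (count-allFin-suc (Vec.lookup (false ∷ p))))

preimage : ∀ {v n} → (Fin v → Fin n) → Subset n → Subset v
preimage φ W = Vec.tabulate (Vec.lookup W ∘ φ)

module _ {v n} {φ : Fin v → Fin n} where

  ∈-preimage : ∀ {W i} → i ∈ preimage φ W ⇔ φ i ∈ W
  ∈-preimage {W} {i} = mk⇔
    (λ i∈ → from ∈⇔T-lookup (subst T (lookup∘tabulate (Vec.lookup W ∘ φ) i) (to ∈⇔T-lookup i∈)))
    (λ φi∈ → from ∈⇔T-lookup (subst T (sym (lookup∘tabulate (Vec.lookup W ∘ φ) i)) (to ∈⇔T-lookup φi∈)))

  preimage-mono : ∀ {W W′} → W ⊆ W′ → preimage φ W ⊆ preimage φ W′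
  preimage-mono W⊆W′ = from ∈-preimage ∘ W⊆W′ ∘ to ∈-preimage

  module _ (φ-inj : Injective _≡_ _≡_ φ) where

    mapsOnto⇒preimage≡ : ∀ {h f} → MapsOnto φ h f → preimage φ f ≡ h
    mapsOnto⇒preimage≡ {h} {f} φh≡f = ⊆-antisym preimage⊆h h⊆preimage
      where
      preimage⊆h : preimage φ f ⊆ h
      preimage⊆h i∈ with to (φh≡f _) (to ∈-preimage i∈)
      ... | i′ , i′∈h , φi′≡φi = subst (_∈ h) (φ-inj φi′≡φi) i′∈h
      h⊆preimage : h ⊆ preimage φ f
      h⊆preimage i∈h = from ∈-preimage (from (φh≡f _) (_ , i∈h , refl))

    ∣preimage∣≡∣W∣ : ∀ {W} → (∀ {j} → j ∈ W → ∃ λ i → φ i ≡ j) → ∣ preimage φ W ∣ ≡ ∣ W ∣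
    ∣preimage∣≡∣W∣ {W} W⊆range = begin
      ∣ preimage φ W ∣                                ≡⟨ ∣p∣≡count-lookup (preimage φ W) ⟩
      count (Vec.lookup (preimage φ W)) (allFin v)    ≡⟨ count-cong (lookup∘tabulate (Vec.lookup W ∘ φ)) (allFin v) ⟩
      count (Vec.lookup W ∘ φ) (allFin v)             ≡⟨ ≤-antisym at-most at-least ⟩
      count (Vec.lookup W) (allFin n)                 ≡⟨ ∣p∣≡count-lookup W ⟨
      ∣ W ∣                                           ∎
      where
      open ≡-Reasoning
      at-most : count (Vec.lookup W ∘ φ) (allFin v) ≤ count (Vec.lookup W) (allFin n)
      at-most = count-≤-injective φ φ-inj (Unique.allFin⁺ v) (λ {i} _ Wφi → ∈-allFin (φ i) , Wφi)
      at-least : count (Vec.lookup W) (allFin n) ≤ count (Vec.lookup W ∘ φ) (allFin v)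
      at-least = count-≤-image φ (Unique.allFin⁺ n) λ _ Wj →
        let i , φi≡j = W⊆range (from ∈⇔T-lookup Wj)
        in i , ∈-allFin i , subst (T ∘ Vec.lookup W) (sym φi≡j) Wj , φi≡j

-- Binomial counts

C-monoˡ-≤ : ∀ {n n′} k → n ≤ n′ → n C k ≤ n′ C k
C-monoˡ-≤ zero _ = ≤-refl
C-monoˡ-≤ {zero} (suc k) _ = z≤n
C-monoˡ-≤ {suc n} {suc n′} (suc k) (s≤s n≤n′) = begin
  suc n C suc k       ≡⟨ nCk+nC[k+1]≡[n+1]C[k+1] n k ⟨
  n C k + n C suc k   ≤⟨ +-mono-≤ (C-monoˡ-≤ k n≤n′) (C-monoˡ-≤ (suc k) n≤n′) ⟩
  n′ C k + n′ C suc k ≡⟨ nCk+nC[k+1]≡[n+1]C[k+1] n′ k ⟩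
  suc n′ C suc k      ∎
  where open ≤-Reasoning

∧-false : ∀ b → ¬ T (b ∧ false)
∧-false b = proj₂ ∘ to T-∧

count-subsets-of : ∀ {n} k (B : Subset n) → count (λ g → (∣ g ∣ ≡ᵇ k) ∧ g ⊆ᵇ B) (allSubsets n) ≡ ∣ B ∣ C k
count-subsets-of zero    [] = refl
count-subsets-of (suc k) [] = refl
count-subsets-of {suc n} k (false ∷ B) = begin
  count (λ g → (∣ g ∣ ≡ᵇ k) ∧ g ⊆ᵇ (false ∷ B)) (allSubsets (suc n))
    ≡⟨ count-allSubsets-suc (λ g → (∣ g ∣ ≡ᵇ k) ∧ g ⊆ᵇ (false ∷ B)) ⟩
  count (λ g → (∣ g ∣ ≡ᵇ k) ∧ g ⊆ᵇ B) S + count (λ g → (suc ∣ g ∣ ≡ᵇ k) ∧ false) S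
    ≡⟨ cong₂ _+_ (count-subsets-of k B) (count-none (λ g → ∧-false (suc ∣ g ∣ ≡ᵇ k)) S) ⟩
  ∣ B ∣ C k + 0
    ≡⟨ +-identityʳ _ ⟩
  ∣ B ∣ C k
    ∎
  where open ≡-Reasoning; S = allSubsets n
count-subsets-of {suc n} zero (true ∷ B) = begin
  count (λ g → (∣ g ∣ ≡ᵇ 0) ∧ g ⊆ᵇ (true ∷ B)) (allSubsets (suc n))
    ≡⟨ count-allSubsets-suc (λ g → (∣ g ∣ ≡ᵇ 0) ∧ g ⊆ᵇ (true ∷ B)) ⟩
  count (λ g → (∣ g ∣ ≡ᵇ 0) ∧ g ⊆ᵇ B) S + count (λ _ → false) S
    ≡⟨ cong₂ _+_ (count-subsets-of zero B) (count-none (λ _ ()) S) ⟩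
  ∣ B ∣ C 0 + 0
    ∎
  where open ≡-Reasoning; S = allSubsets n
count-subsets-of {suc n} (suc k) (true ∷ B) = begin
  count (λ g → (∣ g ∣ ≡ᵇ suc k) ∧ g ⊆ᵇ (true ∷ B)) (allSubsets (suc n))
    ≡⟨ count-allSubsets-suc (λ g → (∣ g ∣ ≡ᵇ suc k) ∧ g ⊆ᵇ (true ∷ B)) ⟩
  count (λ g → (∣ g ∣ ≡ᵇ suc k) ∧ g ⊆ᵇ B) S + count (λ g → (∣ g ∣ ≡ᵇ k) ∧ g ⊆ᵇ B) S
    ≡⟨ cong₂ _+_ (count-subsets-of (suc k) B) (count-subsets-of k B) ⟩
  ∣ B ∣ C suc k + ∣ B ∣ C k
    ≡⟨ +-comm (∣ B ∣ C suc k) _ ⟩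
  ∣ B ∣ C k + ∣ B ∣ C suc k
    ≡⟨ nCk+nC[k+1]≡[n+1]C[k+1] ∣ B ∣ k ⟩
  suc ∣ B ∣ C suc k
    ∎
  where open ≡-Reasoning; S = allSubsets n

count-subsets : ∀ n k → count (λ g → ∣ g ∣ ≡ᵇ k) (allSubsets n) ≡ n C k
count-subsets n k = begin
  count (λ g → ∣ g ∣ ≡ᵇ k) (allSubsets n)          ≡⟨ count-cong (λ g → sym (⊆⊤-trivial g)) (allSubsets n) ⟩
  count (λ g → (∣ g ∣ ≡ᵇ k) ∧ g ⊆ᵇ ⊤) (allSubsets n) ≡⟨ count-subsets-of k (⊤ {n}) ⟩
  ∣ ⊤ {n} ∣ C k                                     ≡⟨ cong (_C k) (∣⊤∣≡n n) ⟩
  n C k                                             ∎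
  where
  open ≡-Reasoning
  ⊆⊤-trivial : ∀ g → (∣ g ∣ ≡ᵇ k) ∧ g ⊆ᵇ ⊤ ≡ (∣ g ∣ ≡ᵇ k)
  ⊆⊤-trivial g = trans (cong ((∣ g ∣ ≡ᵇ k) ∧_) (to T-≡ (⊆⇒⊆ᵇ {p = g} (λ _ → ∈⊤)))) (∧-identityʳ _)

degree : ∀ {n} → Hypergraph n → Subset n → ℕ
degree {n} G W = count (λ f → G f ∧ W ⊆ᵇ f) (allSubsets n)

complete : ∀ {n} → ℕ → Hypergraph n
complete k g = ∣ g ∣ ≡ᵇ k

-- Sizes are written ∣ A ∣ + j so that the induction avoids truncated subtraction.
degree-complete : ∀ {n} (A : Subset n) j → degree (complete (∣ A ∣ + j)) A ≡ (n ∸ ∣ A ∣) C j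
degree-complete []         zero    = refl
degree-complete []         (suc j) = refl
degree-complete {suc n} (true ∷ A) j = begin
  degree (complete (∣ true ∷ A ∣ + j)) (true ∷ A)
    ≡⟨ count-allSubsets-suc (λ g → complete (∣ true ∷ A ∣ + j) g ∧ (true ∷ A) ⊆ᵇ g) ⟩
  count (λ g → (∣ g ∣ ≡ᵇ suc (∣ A ∣ + j)) ∧ false) S + degree (complete (∣ A ∣ + j)) A
    ≡⟨ cong (_+ degree (complete (∣ A ∣ + j)) A) (count-none (λ g → ∧-false (∣ g ∣ ≡ᵇ suc (∣ A ∣ + j))) S) ⟩
  degree (complete (∣ A ∣ + j)) A
    ≡⟨ degree-complete A j ⟩
  (n ∸ ∣ A ∣) C j
    ∎
  where open ≡-Reasoning; S = allSubsets n
degree-complete {suc n} (false ∷ A) zero = begin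
  degree (complete (∣ A ∣ + 0)) (false ∷ A)
    ≡⟨ count-allSubsets-suc (λ g → complete (∣ A ∣ + 0) g ∧ (false ∷ A) ⊆ᵇ g) ⟩
  degree (complete (∣ A ∣ + 0)) A + count (λ g → (suc ∣ g ∣ ≡ᵇ ∣ A ∣ + 0) ∧ A ⊆ᵇ g) S
    ≡⟨ cong₂ _+_ (degree-complete A zero) (count-none no-smaller-superset S) ⟩
  (n ∸ ∣ A ∣) C 0 + 0
    ∎
  where
  open ≡-Reasoning
  S = allSubsets n
  no-smaller-superset : ∀ g → ¬ T ((suc ∣ g ∣ ≡ᵇ ∣ A ∣ + 0) ∧ A ⊆ᵇ g)
  no-smaller-superset g t with to T-∧ t
  ... | |g|+1≡|A|+0 , A⊆g = 1+n≰n (≤-trans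
    (≤-reflexive (trans (≡ᵇ⇒≡ _ _ |g|+1≡|A|+0) (+-identityʳ ∣ A ∣)))
    (p⊆q⇒∣p∣≤∣q∣ (⊆ᵇ⇒⊆ {p = A} {g} A⊆g)))
degree-complete {suc n} (false ∷ A) (suc j) = begin
  degree (complete (∣ A ∣ + suc j)) (false ∷ A)
    ≡⟨ count-allSubsets-suc (λ g → complete (∣ A ∣ + suc j) g ∧ (false ∷ A) ⊆ᵇ g) ⟩
  degree (complete (∣ A ∣ + suc j)) A + count (λ g → (suc ∣ g ∣ ≡ᵇ ∣ A ∣ + suc j) ∧ A ⊆ᵇ g) S
    ≡⟨ cong (degree (complete (∣ A ∣ + suc j)) A +_)
            (cong (λ k → count (λ g → (suc ∣ g ∣ ≡ᵇ k) ∧ A ⊆ᵇ g) S) (+-suc ∣ A ∣ j)) ⟩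
  degree (complete (∣ A ∣ + suc j)) A + degree (complete (∣ A ∣ + j)) A
    ≡⟨ cong₂ _+_ (degree-complete A (suc j)) (degree-complete A j) ⟩
  (n ∸ ∣ A ∣) C suc j + (n ∸ ∣ A ∣) C j
    ≡⟨ +-comm ((n ∸ ∣ A ∣) C suc j) _ ⟩
  (n ∸ ∣ A ∣) C j + (n ∸ ∣ A ∣) C suc j
    ≡⟨ nCk+nC[k+1]≡[n+1]C[k+1] (n ∸ ∣ A ∣) j ⟩
  suc (n ∸ ∣ A ∣) C suc j
    ≡⟨ cong (_C suc j) (+-∸-assoc 1 (∣p∣≤n A)) ⟨
  (suc n ∸ ∣ A ∣) C suc j
    ∎
  where open ≡-Reasoning; S = allSubsets n

degree-complete′ : ∀ {n m r} (U : Subset n) → ∣ U ∣ ≡ m → m ≤ r → degree (complete r) U ≡ (n ∸ m) C (r ∸ m)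
degree-complete′ {n} {r = r} U refl m≤r =
  subst (λ k → degree (complete k) U ≡ (n ∸ ∣ U ∣) C (r ∸ ∣ U ∣)) (m+[n∸m]≡n m≤r) (degree-complete U (r ∸ ∣ U ∣))

-- Links and copies of H

link⇒edge : ∀ {v} {H : Hypergraph v} {U t} → T (link H U t) → ∃ λ h → T (H h ∧ U ⊆ᵇ h) × h ─ U ≡ t
link⇒edge {v} {H} {U} Lt with satisfied (any⁻ _ (allSubsets v) Lt)
... | h , Ht with to (T-∧ {H h}) Ht
... | Hh , rest with to (T-∧ {U ⊆ᵇ h}) rest
... | U⊆h , h─U=t = h , from (T-∧ {H h}) (Hh , U⊆h) , ==ᵇ⇒≡ h─U=t

linkSize≤degree : ∀ {v} (H : Hypergraph v) U → linkSize H U ≤ degree H U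
linkSize≤degree {v} H U = count-≤-image (_─ U) (allSubsets-unique v) λ _ Lt →
  let h , HU⊆h , h─U≡t = link⇒edge {H = H} {U} Lt in h , allSubsets-complete h , HU⊆h , h─U≡t

linkSize≢0 : ∀ {v} {H : Hypergraph v} {U h} → IsEdge H h → U ⊆ h → linkSize H U ≢ 0
linkSize≢0 {H = H} {U} {h} Hh U⊆h = count-≢0 (allSubsets-complete (h ─ U))
  (any⁺ _ (lose (allSubsets-complete h)
    (from (T-∧ {H h}) (from T-≡ Hh , from (T-∧ {U ⊆ᵇ h}) (⊆⇒⊆ᵇ U⊆h , ==ᵇ-refl (h ─ U))))))

linkSize≤binomial : ∀ {v r m} {H : Hypergraph v} → Uniform r H →
  ∀ U → ∣ U ∣ ≡ m → m ≤ r → linkSize H U ≤ (v ∸ m) C (r ∸ m)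
linkSize≤binomial {v} {r} {m} {H} H-unif U |U|≡m m≤r = begin
  linkSize H U          ≤⟨ linkSize≤degree H U ⟩
  degree H U            ≤⟨ count-mono edge⇒r-set (allSubsets v) ⟩
  degree (complete r) U ≡⟨ degree-complete′ U |U|≡m m≤r ⟩
  (v ∸ m) C (r ∸ m)     ∎
  where
  open ≤-Reasoning
  edge⇒r-set : ∀ f → T (H f ∧ U ⊆ᵇ f) → T (complete r f ∧ U ⊆ᵇ f)
  edge⇒r-set f t =
    let Hf , U⊆f = to (T-∧ {H f}) t
    in from (T-∧ {complete r f}) (≡⇒≡ᵇ ∣ f ∣ r (H-unif f (to T-≡ Hf)) , U⊆f)

IsHomomorphism : ∀ {v n} → (Fin v → Fin n) → Hypergraph v → Hypergraph n → Set
IsHomomorphism φ H G = ∀ h → IsEdge H h → ∃ λ f → IsEdge G f × MapsOnto φ h f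

degree-preimage≤degree : ∀ {v n} {φ : Fin v → Fin n} {H G W} →
  Injective _≡_ _≡_ φ → IsHomomorphism φ H G → (∀ {j} → j ∈ W → ∃ λ i → φ i ≡ j) →
  degree H (preimage φ W) ≤ degree G W
degree-preimage≤degree {v} {φ = φ} {H} {G} {W} φ-inj hom W⊆range =
  count-≤-image (preimage φ) (allSubsets-unique v) λ {h} _ t →
    let Hh , W′⊆h = to (T-∧ {H h}) t
        f , Gf , φh≡f = hom h (to T-≡ Hh)
    in f , allSubsets-complete f , from (T-∧ {G f}) (from T-≡ Gf , ⊆⇒⊆ᵇ (W⊆image W′⊆h φh≡f)) ,
       mapsOnto⇒preimage≡ φ-inj φh≡f
  where
  W⊆image : ∀ {h f} → T (preimage φ W ⊆ᵇ h) → MapsOnto φ h f → W ⊆ f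
  W⊆image W′⊆h φh≡f j∈W =
    let i , φi≡j = W⊆range j∈W
    in from (φh≡f _) (i , ⊆ᵇ⇒⊆ W′⊆h (from ∈-preimage (subst (_∈ W) (sym φi≡j) j∈W)) , φi≡j)

copy⇒δ≤degree : ∀ {v n m δ} {H : Hypergraph v} {G : Hypergraph n} {e W} →
  MinCodegreeIs H m δ → ContainsCopyWith H G e → W ⊆ e → ∣ W ∣ ≡ m → δ ≤ degree G W
copy⇒δ≤degree {m = m} {δ} {H} {G} {W = W} (_ , _ , δ-min) (φ , φ-inj , hom , h₀ , Hh₀ , φh₀≡e) W⊆e |W|≡m =
  begin
    δ                      ≤⟨ δ-min W′ |W′|≡m (linkSize≢0 {H = H} Hh₀ W′⊆h₀) ⟩
    linkSize H W′          ≤⟨ linkSize≤degree H W′ ⟩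
    degree H W′            ≤⟨ degree-preimage≤degree φ-inj hom W⊆range ⟩
    degree G W             ∎
  where
  open ≤-Reasoning
  W′ = preimage φ W
  W⊆range : ∀ {j} → j ∈ W → ∃ λ i → φ i ≡ j
  W⊆range j∈W = let i , _ , φi≡j = to (φh₀≡e _) (W⊆e j∈W) in i , φi≡j
  |W′|≡m : ∣ W′ ∣ ≡ m
  |W′|≡m = trans (∣preimage∣≡∣W∣ φ-inj W⊆range) |W|≡m
  W′⊆h₀ : W′ ⊆ h₀
  W′⊆h₀ = subst (W′ ⊆_) (mapsOnto⇒preimage≡ φ-inj φh₀≡e) (preimage-mono W⊆e)

-- Weak saturation

degree-addEdge≤1+degree : ∀ {n} (G : Hypergraph n) e W → degree (addEdge G e) W ≤ suc (degree G W)
degree-addEdge≤1+degree {n} G e W = count-≤-suc e (allSubsets-unique n) (λ _ → new-or-old)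
  where
  new-or-old : ∀ {f} → T (addEdge G e f ∧ W ⊆ᵇ f) → f ≡ e ⊎ T (G f ∧ W ⊆ᵇ f)
  new-or-old {f} t with to (T-∧ {addEdge G e f}) t
  ... | G+ef , W⊆f with to (T-∨ {G f}) G+ef
  ...   | inj₁ Gf  = inj₂ (from (T-∧ {G f}) (Gf , W⊆f))
  ...   | inj₂ f=e = inj₁ (==ᵇ⇒≡ f=e)

⊈⇒degree-addEdge≤degree : ∀ {n} (G : Hypergraph n) {e} W → ¬ T (W ⊆ᵇ e) → degree (addEdge G e) W ≤ degree G W
⊈⇒degree-addEdge≤degree {n} G {e} W W⊈e = count-mono old (allSubsets n)
  where
  old : ∀ f → T (addEdge G e f ∧ W ⊆ᵇ f) → T (G f ∧ W ⊆ᵇ f)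
  old f t with to (T-∧ {addEdge G e f}) t
  ... | G+ef , W⊆f with to (T-∨ {G f}) G+ef
  ...   | inj₁ Gf  = from (T-∧ {G f}) (Gf , W⊆f)
  ...   | inj₂ f=e = contradiction (subst (T ∘ (W ⊆ᵇ_)) (==ᵇ⇒≡ f=e) W⊆f) W⊈e

saturating⇒δ≤1+degree : ∀ {v n m δ} {H : Hypergraph v} {G : Hypergraph n} {W es} →
  MinCodegreeIs H m δ → ∣ W ∣ ≡ m → SaturatingSeq H G es → Any (λ e → T (W ⊆ᵇ e)) es →
  δ ≤ suc (degree G W)
saturating⇒δ≤1+degree {G = G} {W} {e ∷ _} H-δ |W|≡m (copy , sat) W⊆some with T? (W ⊆ᵇ e) | W⊆some
... | yes W⊆e | _ =
  ≤-trans (copy⇒δ≤degree {W = W} H-δ copy (⊆ᵇ⇒⊆ W⊆e) |W|≡m) (degree-addEdge≤1+degree G e W)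
... | no W⊈e | here W⊆e = contradiction W⊆e W⊈e
... | no W⊈e | there W⊆later =
  ≤-trans (saturating⇒δ≤1+degree {W = W} H-δ |W|≡m sat W⊆later) (s≤s (⊈⇒degree-addEdge≤degree G W W⊈e))

weaklySaturated⇒δ≤1+degree : ∀ {r m δ v n} {H : Hypergraph v} {F : Hypergraph n} →
  Uniform r H → MinCodegreeIs H m δ → m ≤ r → v ≤ n → WeaklySaturated r H F →
  ∀ W → ∣ W ∣ ≡ m → δ ≤ suc (degree F W)
weaklySaturated⇒δ≤1+degree {r} {m} {δ} {v} {n} {H} {F}
  H-unif H-δ@(_ , (U₀ , |U₀|≡m , |L[U₀]|≡δ) , _) m≤r v≤n (_ , es , _ , es-complete , sat) W |W|≡m
  with any? (λ e → T? (W ⊆ᵇ e)) es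
... | yes W⊆some = saturating⇒δ≤1+degree {W = W} H-δ |W|≡m sat W⊆some
... | no W⊈any = m≤n⇒m≤1+n (begin
  δ                     ≡⟨ |L[U₀]|≡δ ⟨
  linkSize H U₀         ≤⟨ linkSize≤binomial H-unif U₀ |U₀|≡m m≤r ⟩
  (v ∸ m) C (r ∸ m)     ≤⟨ C-monoˡ-≤ (r ∸ m) (∸-monoˡ-≤ m v≤n) ⟩
  (n ∸ m) C (r ∸ m)     ≡⟨ degree-complete′ W |W|≡m m≤r ⟨
  degree (complete r) W ≤⟨ count-mono r-set⇒edge (allSubsets n) ⟩
  degree F W            ∎)
  where
  open ≤-Reasoning
  r-set⇒edge : ∀ f → T (complete r f ∧ W ⊆ᵇ f) → T (F f ∧ W ⊆ᵇ f)
  r-set⇒edge f t with to (T-∧ {complete r f}) t | F f in Ff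
  ... | _ , W⊆f | true = W⊆f
  ... | |f|≡r , W⊆f | false =
    contradiction (lose (from (es-complete f) (≡ᵇ⇒≡ ∣ f ∣ r |f|≡r , Ff)) W⊆f) W⊈any

-- Double counting

handshake : ∀ {n r} {F : Hypergraph n} → Uniform r F → ∀ m →
  sum (map (λ U → if ∣ U ∣ ≡ᵇ m then degree F U else 0) (allSubsets n)) ≡ numEdges F * (r C m)
handshake {n} {r} {F} F-unif m = begin
  sum (map (λ U → if ∣ U ∣ ≡ᵇ m then degree F U else 0) S) ≡⟨ sum-cong per-subset S ⟩
  sum (map (λ U → count (R U) S) S)                         ≡⟨ double-counting R S S ⟩
  sum (map (λ f → count (λ U → R U f) S) S)                 ≡⟨ sum-cong per-edge S ⟩
  sum (map (λ f → if F f then r C m else 0) S)              ≡⟨ sum-map-if F (r C m) S ⟩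
  (r C m) * numEdges F                                       ≡⟨ *-comm (r C m) (numEdges F) ⟩
  numEdges F * (r C m)                                       ∎
  where
  open ≡-Reasoning
  S = allSubsets n
  R : Subset n → Subset n → Bool
  R U f = (∣ U ∣ ≡ᵇ m) ∧ (F f ∧ U ⊆ᵇ f)
  per-subset : ∀ U → (if ∣ U ∣ ≡ᵇ m then degree F U else 0) ≡ count (R U) S
  per-subset U with ∣ U ∣ ≡ᵇ m
  ... | true  = refl
  ... | false = sym (count-none (λ _ ()) S)
  per-edge : ∀ f → count (λ U → R U f) S ≡ (if F f then r C m else 0)
  per-edge f with F f in Ff
  ... | true  = trans (count-subsets-of m f) (cong (_C m) (F-unif f Ff))
  ... | false = count-none (λ U → ∧-false (∣ U ∣ ≡ᵇ m)) S

proposition2p12 : (r δ m v : ℕ) → 1 ≤ r → 1 ≤ δ → m ≤ r →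
    (H : Hypergraph v) → Uniform r H → MinCodegreeIs H m δ →
    (n : ℕ) → v ≤ n → (F : Hypergraph n) → WeaklySaturated r H F →
    (δ ∸ 1) * (n C m) ≤ numEdges F * (r C m)
proposition2p12 r δ m v _ _ m≤r H H-unif H-δ n v≤n F F-sat@(F-unif , _) = begin
  (δ ∸ 1) * (n C m)                                          ≡⟨ cong ((δ ∸ 1) *_) (count-subsets n m) ⟨
  (δ ∸ 1) * count (λ U → ∣ U ∣ ≡ᵇ m) S                        ≡⟨ sum-map-if (λ U → ∣ U ∣ ≡ᵇ m) (δ ∸ 1) S ⟨
  sum (map (λ U → if ∣ U ∣ ≡ᵇ m then δ ∸ 1 else 0) S)        ≤⟨ sum-mono degree-bound S ⟩
  sum (map (λ U → if ∣ U ∣ ≡ᵇ m then degree F U else 0) S)   ≡⟨ handshake F-unif m ⟩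
  numEdges F * (r C m)                                       ∎
  where
  open ≤-Reasoning
  S = allSubsets n
  degree-bound : ∀ U → (if ∣ U ∣ ≡ᵇ m then δ ∸ 1 else 0) ≤ (if ∣ U ∣ ≡ᵇ m then degree F U else 0)
  degree-bound U with ∣ U ∣ ≡ᵇ m in |U|≡ᵇm
  ... | false = z≤n
  ... | true  = ∸-monoˡ-≤ 1
    (weaklySaturated⇒δ≤1+degree H-unif H-δ m≤r v≤n F-sat U (≡ᵇ⇒≡ ∣ U ∣ m (from T-≡ |U|≡ᵇm)))
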